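{- Let $S=S(\ell_1,\ldots,\ell_k)$ be a spider on $n$ vertices and let $v$ be a leaf of $S$. Suppose that $r$ is a positive integer with $r\le\alpha(S)$. Then \[s_r(v)\ge \binom{n-r-1}{r-1}+\binom{n-k-r-2}{r-2}.\]
   Context: A split vertex of a graph is a vertex of degree at least 3. A spider is a tree with exactly one split vertex; for a spider with split vertex $w$ and leaves $v_1,\ldots,v_k$ one writes $S=S(\ell_1,\ldots,\ell_k)$ where $\ell_i$ is the distance from $w$ to $v_i$ (so $k\ge 3$ is the number of leaves). $\alpha(S)$ is the independence number of $S$, and $s_r(v)$ denotes the number of independent sets of $S$ of size exactly $r$ containing $v$. Binomial coefficients $\binom{a}{b}$ are taken to be $0$ when $b<0$ or $a<b$. -}

module Defs where

open import Data.Bool using (Bool; true; false; _∧_; not; if_then_else_)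
open import Data.Nat using (ℕ; zero; suc; _+_; _⊔_)
open import Data.Nat.Combinatorics using (_C_)
open import Data.Integer using (ℤ; +_; -[1+_])
open import Data.Nat.ListAction using (sum)
open import Data.List using (List; []; _∷_; length; map; concatMap; foldr)
open import Data.Vec using (Vec; []; _∷_)
open import Data.Fin using (Fin; zero; suc)
open import Data.Product using (_×_; _,_)
open import Data.Unit using (⊤; tt)

-- Binomial coefficient with integer arguments: 0 when b < 0 or a < b
-- (in particular when a < 0 ≤ b).
binom : ℤ → ℤ → ℕ
binom (+ a) (+ b) = a C b
binom _ _ = 0

-- The spider S(ℓ₁,…,ℓₖ) is given by its list of leg lengths ls = [ℓ₁,…,ℓₖ].
-- Vertices: the split vertex w, and for each leg i the vertices
-- x_{i,1},…,x_{i,ℓᵢ} at distance 1,…,ℓᵢ from w.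
-- Edges: w — x_{i,1}, and x_{i,j} — x_{i,j+1}.  The leaf vᵢ is x_{i,ℓᵢ}.
-- A vertex subset is a Bool for w together with, for each leg i,
-- a Vec Bool ℓᵢ whose j-th entry (0-based) says whether x_{i,j+1} is in it.

LegSets : List ℕ → Set
LegSets [] = ⊤
LegSets (l ∷ ls) = Vec Bool l × LegSets ls

VSubset : List ℕ → Set
VSubset ls = Bool × LegSets ls

allVecs : (m : ℕ) → List (Vec Bool m)
allVecs zero = [] ∷ []
allVecs (suc m) = concatMap (λ v → (false ∷ v) ∷ (true ∷ v) ∷ []) (allVecs m)

allLegSets : (ls : List ℕ) → List (LegSets ls)
allLegSets [] = tt ∷ []
allLegSets (l ∷ ls) =
  concatMap (λ v → map (λ rest → v , rest) (allLegSets ls)) (allVecs l)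

allSubsets : (ls : List ℕ) → List (VSubset ls)
allSubsets ls =
  concatMap (λ c → map (λ legs → c , legs) (allLegSets ls)) (false ∷ true ∷ [])

firstOf : {m : ℕ} → Vec Bool m → Bool
firstOf [] = false
firstOf (x ∷ _) = x

lastOf : {m : ℕ} → Vec Bool m → Bool
lastOf [] = false
lastOf (x ∷ []) = x
lastOf (_ ∷ y ∷ v) = lastOf (y ∷ v)

noAdjVec : {m : ℕ} → Vec Bool m → Bool
noAdjVec [] = true
noAdjVec (x ∷ []) = true
noAdjVec (x ∷ y ∷ v) = not (x ∧ y) ∧ noAdjVec (y ∷ v)

indepLegs : (c : Bool) (ls : List ℕ) → LegSets ls → Bool
indepLegs c [] tt = true
indepLegs c (l ∷ ls) (v , rest) =
  not (c ∧ firstOf v) ∧ noAdjVec v ∧ indepLegs c ls rest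

isIndep : (ls : List ℕ) → VSubset ls → Bool
isIndep ls (c , legs) = indepLegs c ls legs

countVec : {m : ℕ} → Vec Bool m → ℕ
countVec [] = 0
countVec (true ∷ v) = suc (countVec v)
countVec (false ∷ v) = countVec v

countLegs : (ls : List ℕ) → LegSets ls → ℕ
countLegs [] tt = 0
countLegs (l ∷ ls) (v , rest) = countVec v + countLegs ls rest

size : (ls : List ℕ) → VSubset ls → ℕ
size ls (true , legs) = suc (countLegs ls legs)
size ls (false , legs) = countLegs ls legs

leafInLegs : (ls : List ℕ) → Fin (length ls) → LegSets ls → Bool
leafInLegs (l ∷ ls) zero (v , _) = lastOf v
leafInLegs (l ∷ ls) (suc i) (_ , rest) = leafInLegs ls i rest

leafIn : (ls : List ℕ) → Fin (length ls) → VSubset ls → Bool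
leafIn ls i (_ , legs) = leafInLegs ls i legs

countWhere : {A : Set} → (A → Bool) → List A → ℕ
countWhere p [] = 0
countWhere p (x ∷ xs) = if p x then suc (countWhere p xs) else countWhere p xs

eqℕ : ℕ → ℕ → Bool
eqℕ zero zero = true
eqℕ zero (suc _) = false
eqℕ (suc _) zero = false
eqℕ (suc m) (suc n) = eqℕ m n

numVertices : List ℕ → ℕ
numVertices ls = suc (sum ls)

alpha : List ℕ → ℕ
alpha ls = foldr _⊔_ 0
  (map (λ X → if isIndep ls X then size ls X else 0) (allSubsets ls))

sr : (ls : List ℕ) → ℕ → Fin (length ls) → ℕ
sr ls r i = countWhere (λ X → isIndep ls X ∧ eqℕ (size ls X) r ∧ leafIn ls i X)
  (allSubsets ls)

{-# OPTIONS --safe #-}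
module Submission where

-- Split the sets counted by s_r(v) by whether they contain the split vertex w.
-- Laying the legs other than v's end to end, with v's leg last, turns every
-- independent r-set of the path P_{n-1} that contains its end vertex into a set
-- counted by s_r(v) avoiding w; deleting the neighbours of w first does the same
-- for (r-1)-sets of a path on n-k-1 vertices and sets containing w. The number of
-- independent s-sets of P_m containing its end vertex satisfies Pascal's rule and
-- is at least C(m-s, s-1), which gives the two binomials. When v is adjacent to w
-- the second family is empty, and the first is compared with P_n instead.

open import Defs
open import Data.Nat using (ℕ; _+_; _≤_)
open import Data.Integer using (+_; _-_)
open import Data.List using (List; length)
open import Data.List.Relation.Unary.All using (All)
open import Data.Fin using (Fin)

open import Data.Bool using (Bool; true; false; _∧_; not; if_then_else_; T)
open import Data.Bool.Properties using (T-∧)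
open import Data.Fin using (zero; suc)
open import Data.Integer using (ℤ; -[1+_]; _⊖_)
import Data.Integer as ℤ
open import Data.Integer.Properties using (⊖-≥; ⊖-<; m-n≡m⊖n)
open import Data.List using ([]; _∷_; map; concatMap; _++_; lookup; removeAt)
open import Data.List.Membership.Propositional.Properties using (∈-lookup)
open import Data.List.Properties using (map-++; map-∘; map-cong; map-id; length-removeAt′)
import Data.List.Relation.Unary.All as All
open import Data.Nat using (zero; suc; pred; _∸_; _<_; _≤′_; ≤′-reflexive; ≤′-step; z≤n; s≤s; _≤?_)
open import Data.Nat.Combinatorics using (_C_; nCk+nC[k+1]≡[n+1]C[k+1])
open import Data.Nat.ListAction using (sum)
open import Data.Nat.ListAction.Properties using (sum-++)
open import Data.Nat.Properties
import Data.Nat.Tactic.RingSolver as ℕ-Ring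
open import Algebra.Properties.CommutativeSemigroup +-commutativeSemigroup using (interchange; x∙yz≈y∙xz; xy∙z≈xz∙y)
import Data.Integer.Tactic.RingSolver as ℤ-Ring
open import Data.Product using (_×_; _,_; proj₁; proj₂)
open import Data.Sum using (inj₁; inj₂)
open import Data.Unit using (tt)
open import Data.Vec using (Vec; []; _∷_) renaming (_++_ to _++ᵥ_)
open import Function using (_∘_; Equivalence)
open import Relation.Binary.PropositionalEquality
open import Relation.Nullary using (¬_; yes; no)

private variable
  A B : Set
  a b m n s : ℕ

ind : Bool → ℕ
ind b = if b then 1 else 0

ind-mono : ∀ {p q} → (T p → T q) → ind p ≤ ind q
ind-mono {false} _ = z≤n
ind-mono {true} {true} _ = ≤-refl
ind-mono {true} {false} p⇒q with () ← p⇒q tt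

ind-false : ∀ {p} → ¬ T p → ind p ≤ 0
ind-false {false} _ = z≤n
ind-false {true} ¬p with () ← ¬p tt

∧-intro : ∀ {p q} → T p → T q → T (p ∧ q)
∧-intro tp tq = Equivalence.from T-∧ (tp , tq)

∧-elim : ∀ {p q} → T (p ∧ q) → T p × T q
∧-elim = Equivalence.to T-∧

eqℕ⇒≡ : ∀ m n → T (eqℕ m n) → m ≡ n
eqℕ⇒≡ zero zero _ = refl
eqℕ⇒≡ (suc m) (suc n) p = cong suc (eqℕ⇒≡ m n p)

≡⇒eqℕ : ∀ {m n} → m ≡ n → T (eqℕ m n)
≡⇒eqℕ {zero} refl = tt
≡⇒eqℕ {suc m} refl = ≡⇒eqℕ {m} refl

-- Sums over Boolean vectors and leg sets

countWhere≡sum : (p : A → Bool) (xs : List A) → countWhere p xs ≡ sum (map (ind ∘ p) xs)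
countWhere≡sum p [] = refl
countWhere≡sum p (x ∷ xs) with p x
... | true = cong suc (countWhere≡sum p xs)
... | false = countWhere≡sum p xs

sum-map-map : (f : B → ℕ) (g : A → B) (xs : List A) → sum (map f (map g xs)) ≡ sum (map (f ∘ g) xs)
sum-map-map f g xs = cong sum (sym (map-∘ xs))

sum-map-+ : (f g : A → ℕ) (xs : List A) →
  sum (map (λ x → f x + g x) xs) ≡ sum (map f xs) + sum (map g xs)
sum-map-+ f g [] = refl
sum-map-+ f g (x ∷ xs) = trans (cong (_+_ (f x + g x)) (sum-map-+ f g xs)) (interchange (f x) (g x) _ _)

sum-map-concatMap : (f : B → ℕ) (g : A → List B) (xs : List A) →
  sum (map f (concatMap g xs)) ≡ sum (map (λ x → sum (map f (g x))) xs)
sum-map-concatMap f g [] = refl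
sum-map-concatMap f g (x ∷ xs) = begin
  sum (map f (g x ++ concatMap g xs))                   ≡⟨ cong sum (map-++ f (g x) _) ⟩
  sum (map f (g x) ++ map f (concatMap g xs))           ≡⟨ sum-++ (map f (g x)) _ ⟩
  sum (map f (g x)) + sum (map f (concatMap g xs))      ≡⟨ cong (_+_ (sum (map f (g x)))) (sum-map-concatMap f g xs) ⟩
  sum (map f (g x)) + sum (map (λ y → sum (map f (g y))) xs) ∎
  where open ≡-Reasoning

Σᵛ : (m : ℕ) → (Vec Bool m → ℕ) → ℕ
Σᵛ zero f = f []
Σᵛ (suc m) f = Σᵛ m (f ∘ (false ∷_)) + Σᵛ m (f ∘ (true ∷_))

Σᵛ-cong : ∀ m {f g : Vec Bool m → ℕ} → (∀ v → f v ≡ g v) → Σᵛ m f ≡ Σᵛ m g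
Σᵛ-cong zero f≗g = f≗g []
Σᵛ-cong (suc m) f≗g = cong₂ _+_ (Σᵛ-cong m (f≗g ∘ (false ∷_))) (Σᵛ-cong m (f≗g ∘ (true ∷_)))

Σᵛ-mono : ∀ m {f g : Vec Bool m → ℕ} → (∀ v → f v ≤ g v) → Σᵛ m f ≤ Σᵛ m g
Σᵛ-mono zero f≤g = f≤g []
Σᵛ-mono (suc m) f≤g = +-mono-≤ (Σᵛ-mono m (f≤g ∘ (false ∷_))) (Σᵛ-mono m (f≤g ∘ (true ∷_)))

Σᵛ-+ : ∀ m (f g : Vec Bool m → ℕ) → Σᵛ m (λ v → f v + g v) ≡ Σᵛ m f + Σᵛ m g
Σᵛ-+ zero f g = refl
Σᵛ-+ (suc m) f g = trans
  (cong₂ _+_ (Σᵛ-+ m (f ∘ (false ∷_)) (g ∘ (false ∷_))) (Σᵛ-+ m (f ∘ (true ∷_)) (g ∘ (true ∷_))))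
  (interchange (Σᵛ m (f ∘ (false ∷_))) _ _ _)

Σᵛ-swap : ∀ a b (h : Vec Bool a → Vec Bool b → ℕ) →
  Σᵛ a (λ x → Σᵛ b (h x)) ≡ Σᵛ b (λ y → Σᵛ a (λ x → h x y))
Σᵛ-swap zero b h = refl
Σᵛ-swap (suc a) b h = trans
  (cong₂ _+_ (Σᵛ-swap a b (h ∘ (false ∷_))) (Σᵛ-swap a b (h ∘ (true ∷_))))
  (sym (Σᵛ-+ b _ _))

Σᵛ-++ : ∀ a b (f : Vec Bool (a + b) → ℕ) → Σᵛ (a + b) f ≡ Σᵛ a (λ u → Σᵛ b (λ v → f (u ++ᵥ v)))
Σᵛ-++ zero b f = refl
Σᵛ-++ (suc a) b f = cong₂ _+_ (Σᵛ-++ a b (f ∘ (false ∷_))) (Σᵛ-++ a b (f ∘ (true ∷_)))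

sum-allVecs : ∀ m (f : Vec Bool m → ℕ) → sum (map f (allVecs m)) ≡ Σᵛ m f
sum-allVecs zero f = +-identityʳ (f [])
sum-allVecs (suc m) f = begin
  sum (map f (allVecs (suc m)))
    ≡⟨ sum-map-concatMap f _ (allVecs m) ⟩
  sum (map (λ v → f (false ∷ v) + (f (true ∷ v) + 0)) (allVecs m))
    ≡⟨ cong sum (map-cong (λ v → cong (_+_ (f (false ∷ v))) (+-identityʳ _)) (allVecs m)) ⟩
  sum (map (λ v → f (false ∷ v) + f (true ∷ v)) (allVecs m))
    ≡⟨ sum-map-+ (f ∘ (false ∷_)) (f ∘ (true ∷_)) (allVecs m) ⟩
  sum (map (f ∘ (false ∷_)) (allVecs m)) + sum (map (f ∘ (true ∷_)) (allVecs m))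
    ≡⟨ cong₂ _+_ (sum-allVecs m _) (sum-allVecs m _) ⟩
  Σᵛ (suc m) f ∎
  where open ≡-Reasoning

Σˡ : (ls : List ℕ) → (LegSets ls → ℕ) → ℕ
Σˡ [] f = f tt
Σˡ (l ∷ ls) f = Σᵛ l (λ v → Σˡ ls (λ L → f (v , L)))

Σˡ-mono : ∀ ls {f g : LegSets ls → ℕ} → (∀ L → f L ≤ g L) → Σˡ ls f ≤ Σˡ ls g
Σˡ-mono [] f≤g = f≤g tt
Σˡ-mono (l ∷ ls) f≤g = Σᵛ-mono l (λ v → Σˡ-mono ls (λ L → f≤g (v , L)))

sum-allLegSets : ∀ ls (f : LegSets ls → ℕ) → sum (map f (allLegSets ls)) ≡ Σˡ ls f
sum-allLegSets [] f = +-identityʳ (f tt)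
sum-allLegSets (l ∷ ls) f = begin
  sum (map f (allLegSets (l ∷ ls)))
    ≡⟨ sum-map-concatMap f _ (allVecs l) ⟩
  sum (map (λ v → sum (map f (map (v ,_) (allLegSets ls)))) (allVecs l))
    ≡⟨ cong sum (map-cong (λ v → trans (sum-map-map f (v ,_) (allLegSets ls)) (sum-allLegSets ls _)) (allVecs l)) ⟩
  sum (map (λ v → Σˡ ls (λ L → f (v , L))) (allVecs l))
    ≡⟨ sum-allVecs l _ ⟩
  Σˡ (l ∷ ls) f ∎
  where open ≡-Reasoning

-- Independent sets of paths

noAdjVec-++ : (u : Vec Bool a) (v : Vec Bool b) → T (noAdjVec (u ++ᵥ v)) → T (noAdjVec u) × T (noAdjVec v)
noAdjVec-++ [] v p = tt , p
noAdjVec-++ (x ∷ []) [] p = tt , tt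
noAdjVec-++ (x ∷ []) (y ∷ v) p = tt , proj₂ (∧-elim {not (x ∧ y)} p)
noAdjVec-++ (x ∷ y ∷ u) v p =
  let x≁y , rest = ∧-elim {not (x ∧ y)} p
      u′ , v′ = noAdjVec-++ (y ∷ u) v rest
  in ∧-intro {not (x ∧ y)} x≁y u′ , v′

countVec-++ : (u : Vec Bool a) (v : Vec Bool b) → countVec (u ++ᵥ v) ≡ countVec u + countVec v
countVec-++ [] v = refl
countVec-++ (true ∷ u) v = cong suc (countVec-++ u v)
countVec-++ (false ∷ u) v = countVec-++ u v

lastOf-++ : (u : Vec Bool a) (v : Vec Bool (suc b)) → lastOf (u ++ᵥ v) ≡ lastOf v
lastOf-++ [] v = refl
lastOf-++ (x ∷ []) (y ∷ v) = refl
lastOf-++ (x ∷ y ∷ u) v = lastOf-++ (y ∷ u) v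

noAdjVec-false∷ : (v : Vec Bool m) → noAdjVec (false ∷ v) ≡ noAdjVec v
noAdjVec-false∷ [] = refl
noAdjVec-false∷ (x ∷ v) = refl

lastOf-false∷ : (v : Vec Bool m) → lastOf (false ∷ v) ≡ lastOf v
lastOf-false∷ [] = refl
lastOf-false∷ (x ∷ v) = refl

endSet : ℕ → Vec Bool m → Bool
endSet s v = noAdjVec v ∧ eqℕ (countVec v) s ∧ lastOf v

endSets : ℕ → ℕ → ℕ
endSets m s = Σᵛ m (ind ∘ endSet s)

endSet-false∷ : (v : Vec Bool m) → endSet s (false ∷ v) ≡ endSet s v
endSet-false∷ {s = s} v = cong₂ (λ p q → p ∧ eqℕ (countVec v) s ∧ q) (noAdjVec-false∷ v) (lastOf-false∷ v)

endSet-++ : (u : Vec Bool a) (v : Vec Bool (suc b)) → T (endSet s (u ++ᵥ v)) →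
  T (noAdjVec u) × T (noAdjVec v) × countVec u + countVec v ≡ s × T (lastOf v)
endSet-++ {s = s} u v p =
  let noAdj , rest = ∧-elim p
      count , last = ∧-elim rest
      noAdjᵘ , noAdjᵛ = noAdjVec-++ u v noAdj
  in noAdjᵘ , noAdjᵛ , trans (sym (countVec-++ u v)) (eqℕ⇒≡ _ s count) , subst T (lastOf-++ u v) last

-- Deleting the first vertex, or the first two when the first one is in the set.
endSets-pascal : ∀ m s → endSets (suc m) (suc s) + endSets m s ≤ endSets (suc (suc m)) (suc s)
endSets-pascal m s = begin
  endSets (suc m) (suc s) + endSets m s
    ≡⟨ cong₂ _+_ (Σᵛ-cong (suc m) (λ v → cong ind (sym (endSet-false∷ {s = suc s} v))))
                 (Σᵛ-cong m (λ v → cong ind (sym (endSet-false∷ {s = s} v)))) ⟩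
  Σᵛ (suc m) (ind ∘ endSet (suc s) ∘ (false ∷_)) + Σᵛ m (ind ∘ endSet (suc s) ∘ (true ∷_) ∘ (false ∷_))
    ≤⟨ +-monoʳ-≤ (Σᵛ (suc m) (ind ∘ endSet (suc s) ∘ (false ∷_))) (m≤m+n _ _) ⟩
  endSets (suc (suc m)) (suc s) ∎
  where open ≤-Reasoning

endSets-step : ∀ m s → endSets m (suc s) ≤ endSets (suc m) (suc s)
endSets-step zero s = z≤n
endSets-step (suc m) s = ≤-trans (m≤m+n _ _) (endSets-pascal m s)

endSets-monoˡ : m ≤′ n → endSets m (suc s) ≤ endSets n (suc s)
endSets-monoˡ (≤′-reflexive refl) = ≤-refl
endSets-monoˡ {s = s} (≤′-step {n} m≤n) = ≤-trans (endSets-monoˡ m≤n) (endSets-step n s)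

1≤endSets : ∀ a → 1 ≤ endSets (suc a) 1
1≤endSets zero = s≤s z≤n
1≤endSets (suc a) = ≤-trans (1≤endSets a) (endSets-step (suc a) 0)

C≤endSets : ∀ a s → a C s ≤ endSets (a + suc s) (suc s)
C≤endSets a zero = subst (λ n → 1 ≤ endSets n 1) (+-comm 1 a) (1≤endSets a)
C≤endSets zero (suc s) = z≤n
C≤endSets (suc a) (suc s) = begin
  suc a C suc s
    ≡⟨ sym (nCk+nC[k+1]≡[n+1]C[k+1] a s) ⟩
  a C s + a C suc s
    ≤⟨ +-mono-≤ (C≤endSets a s) (C≤endSets a (suc s)) ⟩
  endSets p (suc s) + endSets (a + suc (suc s)) (suc (suc s))
    ≡⟨ +-comm (endSets p (suc s)) _ ⟩
  endSets (a + suc (suc s)) (suc (suc s)) + endSets p (suc s)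
    ≡⟨ cong (λ n → endSets n (suc (suc s)) + endSets p (suc s)) (+-suc a (suc s)) ⟩
  endSets (suc p) (suc (suc s)) + endSets p (suc s)
    ≤⟨ endSets-pascal p (suc s) ⟩
  endSets (suc (suc p)) (suc (suc s))
    ≡⟨ cong (λ n → endSets (suc n) (suc (suc s))) (sym (+-suc a (suc s))) ⟩
  endSets (suc a + suc (suc s)) (suc (suc s)) ∎
  where
  open ≤-Reasoning
  p = a + suc s

endPairSet : ℕ → Vec Bool a → Vec Bool b → Bool
endPairSet s w u = noAdjVec w ∧ noAdjVec u ∧ eqℕ (countVec w + countVec u) s ∧ lastOf u

endPairSets : ℕ → ℕ → ℕ → ℕ
endPairSets a b s = Σᵛ a (λ w → Σᵛ b (ind ∘ endPairSet s w))

endPairSet-intro : (w : Vec Bool a) (u : Vec Bool b) →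
  T (noAdjVec w) → T (noAdjVec u) → countVec w + countVec u ≡ s → T (lastOf u) → T (endPairSet s w u)
endPairSet-intro w u noAdjʷ noAdjᵘ count≡s last =
  ∧-intro noAdjʷ (∧-intro noAdjᵘ (∧-intro (≡⇒eqℕ count≡s) last))

endPairSet-elim : (w : Vec Bool a) (u : Vec Bool b) → T (endPairSet s w u) →
  T (noAdjVec w) × T (noAdjVec u) × countVec w + countVec u ≡ s × T (lastOf u)
endPairSet-elim {s = s} w u p =
  let noAdjʷ , rest = ∧-elim p
      noAdjᵘ , rest′ = ∧-elim rest
      count , last = ∧-elim rest′
  in noAdjʷ , noAdjᵘ , eqℕ⇒≡ _ s count , last

endSets-++ : ∀ a b s → 1 ≤ b → endSets (a + b) s ≤ endPairSets a b s
endSets-++ a (suc b) s _ = begin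
  endSets (a + suc b) s
    ≡⟨ Σᵛ-++ a (suc b) _ ⟩
  Σᵛ a (λ w → Σᵛ (suc b) (λ u → ind (endSet s (w ++ᵥ u))))
    ≤⟨ Σᵛ-mono a (λ w → Σᵛ-mono (suc b) (λ u → ind-mono (λ p →
         let noAdjʷ , noAdjᵘ , count≡s , last = endSet-++ {s = s} w u p
         in endPairSet-intro w u noAdjʷ noAdjᵘ count≡s last))) ⟩
  endPairSets a (suc b) s ∎
  where open ≤-Reasoning

-- A path with two extra vertices: its last vertex plays the one-vertex path,
-- the vertex before it is forced out of the set.
endSets-+2 : ∀ a s → endSets (a + 2) (suc s) ≤ endPairSets a 1 (suc s)
endSets-+2 a s = begin
  endSets (a + 2) (suc s)
    ≡⟨ Σᵛ-++ a 2 _ ⟩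
  Σᵛ a (λ w → Σᵛ 2 (λ u → ind (endSet (suc s) (w ++ᵥ u))))
    ≤⟨ Σᵛ-mono a lastTwo ⟩
  endPairSets a 1 (suc s) ∎
  where
  open ≤-Reasoning
  lastTwo : (w : Vec Bool a) → Σᵛ 2 (λ u → ind (endSet (suc s) (w ++ᵥ u))) ≤ Σᵛ 1 (ind ∘ endPairSet (suc s) w)
  lastTwo w = begin
    (g (false ∷ false ∷ []) + g (false ∷ true ∷ [])) + (g (true ∷ false ∷ []) + g (true ∷ true ∷ []))
      ≤⟨ +-mono-≤ (+-mono-≤ (notLast false) fromFalseTrue) (+-mono-≤ (notLast true) notAdj) ⟩
    (0 + h (true ∷ [])) + (0 + 0)
      ≡⟨ +-identityʳ _ ⟩
    h (true ∷ [])
      ≤⟨ m≤n+m _ _ ⟩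
    h (false ∷ []) + h (true ∷ []) ∎
    where
    g : Vec Bool 2 → ℕ
    g u = ind (endSet (suc s) (w ++ᵥ u))
    h : Vec Bool 1 → ℕ
    h u = ind (endPairSet (suc s) w u)
    notLast : ∀ x → g (x ∷ false ∷ []) ≤ 0
    notLast x = ind-false (λ p → let _ , _ , _ , last = endSet-++ {s = suc s} w (x ∷ false ∷ []) p in last)
    notAdj : g (true ∷ true ∷ []) ≤ 0
    notAdj = ind-false (λ p → let _ , noAdjᵘ , _ , _ = endSet-++ {s = suc s} w (true ∷ true ∷ []) p in noAdjᵘ)
    fromFalseTrue : g (false ∷ true ∷ []) ≤ h (true ∷ [])
    fromFalseTrue = ind-mono (λ p →
      let noAdjʷ , _ , count≡s , _ = endSet-++ {s = suc s} w (false ∷ true ∷ []) p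
      in endPairSet-intro w (true ∷ []) noAdjʷ tt count≡s tt)

-- Independent sets of the spider

leafSet : (c : Bool) (ls : List ℕ) → Fin (length ls) → ℕ → LegSets ls → Bool
leafSet c ls i s L = indepLegs c ls L ∧ eqℕ (countLegs ls L) s ∧ leafInLegs ls i L

leafSets : Bool → (ls : List ℕ) → Fin (length ls) → ℕ → ℕ
leafSets c ls i s = Σˡ ls (ind ∘ leafSet c ls i s)

sr≡leafSets : ∀ ls i r → sr ls (suc r) i ≡ leafSets false ls i (suc r) + leafSets true ls i r
sr≡leafSets ls i r = begin
  sr ls (suc r) i
    ≡⟨ countWhere≡sum P (allSubsets ls) ⟩
  sum (map (ind ∘ P) (allSubsets ls))
    ≡⟨ sum-map-concatMap (ind ∘ P) (λ c → map (c ,_) (allLegSets ls)) (false ∷ true ∷ []) ⟩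
  sum (map (ind ∘ P) (map (false ,_) (allLegSets ls))) + (sum (map (ind ∘ P) (map (true ,_) (allLegSets ls))) + 0)
    ≡⟨ cong₂ _+_ (sumOver false) (trans (+-identityʳ _) (sumOver true)) ⟩
  leafSets false ls i (suc r) + leafSets true ls i r ∎
  where
  open ≡-Reasoning
  P : VSubset ls → Bool
  P X = isIndep ls X ∧ eqℕ (size ls X) (suc r) ∧ leafIn ls i X
  sumOver : ∀ c → sum (map (ind ∘ P) (map (c ,_) (allLegSets ls))) ≡ Σˡ ls (ind ∘ P ∘ (c ,_))
  sumOver c = trans (sum-map-map (ind ∘ P) (c ,_) (allLegSets ls)) (sum-allLegSets ls _)

insertLeg : (ls : List ℕ) (i : Fin (length ls)) → Vec Bool (lookup ls i) → LegSets (removeAt ls i) → LegSets ls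
insertLeg (l ∷ ls) zero u L = u , L
insertLeg (l ∷ ls) (suc i) u (v , L) = v , insertLeg ls i u L

Σˡ-insertLeg : ∀ ls i (f : LegSets ls → ℕ) →
  Σˡ ls f ≡ Σᵛ (lookup ls i) (λ u → Σˡ (removeAt ls i) (f ∘ insertLeg ls i u))
Σˡ-insertLeg (l ∷ ls) zero f = refl
Σˡ-insertLeg (l ∷ ls) (suc i) f = trans
  (Σᵛ-cong l (λ v → Σˡ-insertLeg ls i (λ L → f (v , L))))
  (Σᵛ-swap l (lookup ls i) (λ v u → Σˡ (removeAt ls i) (λ L → f (v , insertLeg ls i u L))))

indepLegs-insertLeg : ∀ c ls i (u : Vec Bool (lookup ls i)) (L : LegSets (removeAt ls i)) →
  T (not (c ∧ firstOf u)) → T (noAdjVec u) → T (indepLegs c (removeAt ls i) L) →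
  T (indepLegs c ls (insertLeg ls i u L))
indepLegs-insertLeg c (l ∷ ls) zero u L free noAdj indep = ∧-intro free (∧-intro noAdj indep)
indepLegs-insertLeg c (l ∷ ls) (suc i) u (v , L) free noAdj indep =
  let freeᵛ , rest = ∧-elim {not (c ∧ firstOf v)} indep
      noAdjᵛ , indepᴸ = ∧-elim rest
  in ∧-intro freeᵛ (∧-intro noAdjᵛ (indepLegs-insertLeg c ls i u L free noAdj indepᴸ))

countLegs-insertLeg : ∀ ls i (u : Vec Bool (lookup ls i)) (L : LegSets (removeAt ls i)) →
  countLegs ls (insertLeg ls i u L) ≡ countVec u + countLegs (removeAt ls i) L
countLegs-insertLeg (l ∷ ls) zero u L = refl
countLegs-insertLeg (l ∷ ls) (suc i) u (v , L) = begin
  countVec v + countLegs ls (insertLeg ls i u L)       ≡⟨ cong (_+_ (countVec v)) (countLegs-insertLeg ls i u L) ⟩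
  countVec v + (countVec u + countLegs (removeAt ls i) L) ≡⟨ x∙yz≈y∙xz (countVec v) (countVec u) _ ⟩
  countVec u + (countVec v + countLegs (removeAt ls i) L) ∎
  where open ≡-Reasoning

leafInLegs-insertLeg : ∀ ls i (u : Vec Bool (lookup ls i)) (L : LegSets (removeAt ls i)) →
  leafInLegs ls i (insertLeg ls i u L) ≡ lastOf u
leafInLegs-insertLeg (l ∷ ls) zero u L = refl
leafInLegs-insertLeg (l ∷ ls) (suc i) u (v , L) = leafInLegs-insertLeg ls i u L

sum-removeAt : ∀ ls i → sum (removeAt ls i) + lookup ls i ≡ sum ls
sum-removeAt (l ∷ ls) zero = +-comm (sum ls) l
sum-removeAt (l ∷ ls) (suc i) = trans (+-assoc l _ _) (cong (_+_ l) (sum-removeAt ls i))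

-- When the split vertex is in the set, the first vertex of every leg is not:
-- only the remaining pred l vertices of a leg of length l are free.
trim : Bool → ℕ → ℕ
trim false l = l
trim true l = pred l

pad : ∀ c l → Vec Bool (trim c l) → Vec Bool l
pad false l v = v
pad true zero v = []
pad true (suc l) v = false ∷ v

pad-indep : ∀ c l (v : Vec Bool (trim c l)) → T (noAdjVec v) →
  T (not (c ∧ firstOf (pad c l v))) × T (noAdjVec (pad c l v))
pad-indep false l v noAdj = tt , noAdj
pad-indep true zero v noAdj = tt , tt
pad-indep true (suc l) v noAdj = tt , subst T (sym (noAdjVec-false∷ v)) noAdj

countVec-pad : ∀ c l (v : Vec Bool (trim c l)) → countVec (pad c l v) ≡ countVec v
countVec-pad false l v = refl
countVec-pad true zero [] = refl
countVec-pad true (suc l) v = refl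

lastOf-pad : ∀ c l (v : Vec Bool (trim c l)) → lastOf (pad c l v) ≡ lastOf v
lastOf-pad false l v = refl
lastOf-pad true zero [] = refl
lastOf-pad true (suc l) v = lastOf-false∷ v

Σᵛ-pad : ∀ c l (f : Vec Bool l → ℕ) → Σᵛ (trim c l) (f ∘ pad c l) ≤ Σᵛ l f
Σᵛ-pad false l f = ≤-refl
Σᵛ-pad true zero f = ≤-refl
Σᵛ-pad true (suc l) f = m≤m+n _ _

padLegs : ∀ c ls → LegSets (map (trim c) ls) → LegSets ls
padLegs c [] tt = tt
padLegs c (l ∷ ls) (v , W) = pad c l v , padLegs c ls W

Σˡ-padLegs : ∀ c ls (f : LegSets ls → ℕ) → Σˡ (map (trim c) ls) (f ∘ padLegs c ls) ≤ Σˡ ls f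
Σˡ-padLegs c [] f = ≤-refl
Σˡ-padLegs c (l ∷ ls) f = ≤-trans
  (Σᵛ-mono (trim c l) (λ v → Σˡ-padLegs c ls (λ L → f (pad c l v , L))))
  (Σᵛ-pad c l (λ v → Σˡ ls (λ L → f (v , L))))

concatLegs : ∀ ls → LegSets ls → Vec Bool (sum ls)
concatLegs [] tt = []
concatLegs (l ∷ ls) (v , W) = v ++ᵥ concatLegs ls W

Σᵛ-concatLegs : ∀ ls (f : Vec Bool (sum ls) → ℕ) → Σᵛ (sum ls) f ≡ Σˡ ls (f ∘ concatLegs ls)
Σᵛ-concatLegs [] f = refl
Σᵛ-concatLegs (l ∷ ls) f = trans (Σᵛ-++ l (sum ls) f)
  (Σᵛ-cong l (λ v → Σᵛ-concatLegs ls (λ w → f (v ++ᵥ w))))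

indepLegs-padLegs : ∀ c ls (W : LegSets (map (trim c) ls)) →
  T (noAdjVec (concatLegs _ W)) → T (indepLegs c ls (padLegs c ls W))
indepLegs-padLegs c [] tt _ = tt
indepLegs-padLegs c (l ∷ ls) (v , W) noAdj =
  let noAdjᵛ , noAdjᵂ = noAdjVec-++ v (concatLegs _ W) noAdj
      free , noAdjᵖ = pad-indep c l v noAdjᵛ
  in ∧-intro free (∧-intro noAdjᵖ (indepLegs-padLegs c ls W noAdjᵂ))

countLegs-padLegs : ∀ c ls (W : LegSets (map (trim c) ls)) →
  countLegs ls (padLegs c ls W) ≡ countVec (concatLegs _ W)
countLegs-padLegs c [] tt = refl
countLegs-padLegs c (l ∷ ls) (v , W) = trans
  (cong₂ _+_ (countVec-pad c l v) (countLegs-padLegs c ls W))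
  (sym (countVec-++ v (concatLegs _ W)))

-- The legs other than the i-th are laid end to end into the first path, and the
-- i-th leg is the second path, with its end vertex the leaf vᵢ.
leafSet-from-endPairSet : ∀ c ls i s (W : LegSets (map (trim c) (removeAt ls i))) (u : Vec Bool (trim c (lookup ls i))) →
  T (endPairSet s (concatLegs _ W) u) →
  T (leafSet c ls i s (insertLeg ls i (pad c (lookup ls i) u) (padLegs c (removeAt ls i) W)))
leafSet-from-endPairSet c ls i s W u p with endPairSet-elim (concatLegs _ W) u p
... | noAdjᵂ , noAdjᵘ , count≡s , last =
  ∧-intro (indepLegs-insertLeg c ls i u′ L free noAdjᵘ′ (indepLegs-padLegs c R W noAdjᵂ))
    (∧-intro (≡⇒eqℕ count) (subst T (sym leaf) last))
  where
  R = removeAt ls i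
  ℓ = lookup ls i
  u′ = pad c ℓ u
  L = padLegs c R W
  free = proj₁ (pad-indep c ℓ u noAdjᵘ)
  noAdjᵘ′ = proj₂ (pad-indep c ℓ u noAdjᵘ)
  count : countLegs ls (insertLeg ls i u′ L) ≡ s
  count = begin
    countLegs ls (insertLeg ls i u′ L)        ≡⟨ countLegs-insertLeg ls i u′ L ⟩
    countVec u′ + countLegs R L               ≡⟨ cong₂ _+_ (countVec-pad c ℓ u) (countLegs-padLegs c R W) ⟩
    countVec u + countVec (concatLegs _ W)   ≡⟨ +-comm (countVec u) _ ⟩
    countVec (concatLegs _ W) + countVec u   ≡⟨ count≡s ⟩
    s ∎
    where open ≡-Reasoning
  leaf : leafInLegs ls i (insertLeg ls i u′ L) ≡ lastOf u
  leaf = trans (leafInLegs-insertLeg ls i u′ L) (lastOf-pad c ℓ u)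

endPairSets-≤-leafSets : ∀ c ls i s →
  endPairSets (sum (map (trim c) (removeAt ls i))) (trim c (lookup ls i)) s ≤ leafSets c ls i s
endPairSets-≤-leafSets c ls i s = begin
  Σᵛ (sum R′) (λ w → Σᵛ (trim c ℓ) (ind ∘ endPairSet s w))
    ≡⟨ Σᵛ-swap (sum R′) (trim c ℓ) _ ⟩
  Σᵛ (trim c ℓ) (λ u → Σᵛ (sum R′) (λ w → ind (endPairSet s w u)))
    ≡⟨ Σᵛ-cong (trim c ℓ) (λ u → Σᵛ-concatLegs R′ _) ⟩
  Σᵛ (trim c ℓ) (λ u → Σˡ R′ (λ W → ind (endPairSet s (concatLegs R′ W) u)))
    ≤⟨ Σᵛ-mono (trim c ℓ) (λ u → Σˡ-mono R′ (λ W → ind-mono (leafSet-from-endPairSet c ls i s W u))) ⟩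
  Σᵛ (trim c ℓ) (λ u → Σˡ R′ (λ W → f (insertLeg ls i (pad c ℓ u) (padLegs c R W))))
    ≤⟨ Σᵛ-mono (trim c ℓ) (λ u → Σˡ-padLegs c R (f ∘ insertLeg ls i (pad c ℓ u))) ⟩
  Σᵛ (trim c ℓ) (λ u → Σˡ R (f ∘ insertLeg ls i (pad c ℓ u)))
    ≤⟨ Σᵛ-pad c ℓ (λ u → Σˡ R (f ∘ insertLeg ls i u)) ⟩
  Σᵛ ℓ (λ u → Σˡ R (f ∘ insertLeg ls i u))
    ≡⟨ sym (Σˡ-insertLeg ls i f) ⟩
  leafSets c ls i s ∎
  where
  open ≤-Reasoning
  R = removeAt ls i
  R′ = map (trim c) R
  ℓ = lookup ls i
  f = ind ∘ leafSet c ls i s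

n≤1+pred[n] : ∀ n → n ≤ suc (pred n)
n≤1+pred[n] zero = z≤n
n≤1+pred[n] (suc n) = ≤-refl

sum≤sum-map-pred+length : ∀ xs → sum xs ≤ sum (map pred xs) + length xs
sum≤sum-map-pred+length [] = z≤n
sum≤sum-map-pred+length (x ∷ xs) = begin
  x + sum xs                                           ≤⟨ +-mono-≤ (n≤1+pred[n] x) (sum≤sum-map-pred+length xs) ⟩
  suc (pred x) + (sum (map pred xs) + length xs)       ≡⟨ reassoc (pred x) (sum (map pred xs)) (length xs) ⟩
  pred x + sum (map pred xs) + suc (length xs) ∎
  where
  open ≤-Reasoning
  reassoc : ∀ p q t → suc p + (q + t) ≡ p + q + suc t
  reassoc = ℕ-Ring.solve-∀

endPairSets-≤-leafSets-false : ∀ ls i s → endPairSets (sum (removeAt ls i)) (lookup ls i) s ≤ leafSets false ls i s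
endPairSets-≤-leafSets-false ls i s =
  subst (λ R → endPairSets (sum R) (lookup ls i) s ≤ leafSets false ls i s) (map-id (removeAt ls i))
    (endPairSets-≤-leafSets false ls i s)

endSets-≤-sr-longLeg : ∀ ls i r → 2 ≤ lookup ls i →
  let M = sum (map pred (removeAt ls i)) + pred (lookup ls i) in
  sum ls ≤ M + length ls × endSets (sum ls) (suc r) + endSets M r ≤ sr ls (suc r) i
endSets-≤-sr-longLeg ls i r ℓ≥2 = S≤M+k , (begin
  endSets (sum ls) (suc r) + endSets M r
    ≡⟨ cong (λ n → endSets n (suc r) + endSets M r) (sym (sum-removeAt ls i)) ⟩
  endSets (sum R + ℓ) (suc r) + endSets M r
    ≤⟨ +-mono-≤ (endSets-++ (sum R) ℓ (suc r) (≤-trans (n≤1+n 1) ℓ≥2))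
                (endSets-++ (sum (map pred R)) (pred ℓ) r (suc[m]≤n⇒m≤pred[n] ℓ≥2)) ⟩
  endPairSets (sum R) ℓ (suc r) + endPairSets (sum (map pred R)) (pred ℓ) r
    ≤⟨ +-mono-≤ (endPairSets-≤-leafSets-false ls i (suc r)) (endPairSets-≤-leafSets true ls i r) ⟩
  leafSets false ls i (suc r) + leafSets true ls i r
    ≡⟨ sym (sr≡leafSets ls i r) ⟩
  sr ls (suc r) i ∎)
  where
  open ≤-Reasoning
  R = removeAt ls i
  ℓ = lookup ls i
  M = sum (map pred R) + pred ℓ
  S≤M+k : sum ls ≤ M + length ls
  S≤M+k = begin
    sum ls                                            ≡⟨ sym (sum-removeAt ls i) ⟩
    sum R + ℓ                                         ≤⟨ +-mono-≤ (sum≤sum-map-pred+length R) (n≤1+pred[n] ℓ) ⟩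
    sum (map pred R) + length R + suc (pred ℓ)        ≡⟨ reassoc (sum (map pred R)) (length R) (pred ℓ) ⟩
    M + suc (length R)                                ≡⟨ cong (_+_ M) (sym (length-removeAt′ ls i)) ⟩
    M + length ls ∎
    where
    reassoc : ∀ p q t → p + q + suc t ≡ p + t + suc q
    reassoc = ℕ-Ring.solve-∀

-- vᵢ is adjacent to the split vertex, so leafSets true vanishes; by Pascal's rule both
-- path counts are absorbed into one for a path two vertices longer.
endSets-≤-sr-shortLeg : ∀ ls i r → lookup ls i ≡ 1 → 1 ≤ length ls →
  let M = sum (removeAt ls i) in
  sum ls ≤ M + length ls × endSets (sum ls) (suc r) + endSets M r ≤ sr ls (suc r) i
endSets-≤-sr-shortLeg ls i r ℓ≡1 k≥1 = S≤M+k , (begin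
  endSets (sum ls) (suc r) + endSets M r
    ≡⟨ cong (λ n → endSets n (suc r) + endSets M r) (sym 1+M≡S) ⟩
  endSets (suc M) (suc r) + endSets M r
    ≤⟨ endSets-pascal M r ⟩
  endSets (suc (suc M)) (suc r)
    ≡⟨ cong (λ n → endSets n (suc r)) (+-comm 2 M) ⟩
  endSets (M + 2) (suc r)
    ≤⟨ endSets-+2 M r ⟩
  endPairSets M 1 (suc r)
    ≡⟨ cong (λ ℓ → endPairSets M ℓ (suc r)) (sym ℓ≡1) ⟩
  endPairSets M (lookup ls i) (suc r)
    ≤⟨ endPairSets-≤-leafSets-false ls i (suc r) ⟩
  leafSets false ls i (suc r)
    ≤⟨ m≤m+n _ _ ⟩
  leafSets false ls i (suc r) + leafSets true ls i r
    ≡⟨ sym (sr≡leafSets ls i r) ⟩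
  sr ls (suc r) i ∎)
  where
  open ≤-Reasoning
  M = sum (removeAt ls i)
  1+M≡S : suc M ≡ sum ls
  1+M≡S = trans (+-comm 1 M) (trans (cong (_+_ M) (sym ℓ≡1)) (sum-removeAt ls i))
  S≤M+k : sum ls ≤ M + length ls
  S≤M+k = subst (_≤ M + length ls) (trans (+-comm M 1) 1+M≡S) (+-monoʳ-≤ M k≥1)

-- Binomial bounds

binom-⊖-≥ : ∀ {a b} t → b ≤ a → binom (a ⊖ b) (+ t) ≡ (a ∸ b) C t
binom-⊖-≥ t b≤a rewrite ⊖-≥ b≤a = refl

binom-⊖-< : ∀ {a b} t → a < b → binom (a ⊖ b) t ≡ 0
binom-⊖-< {a} {b} t a<b rewrite ⊖-< a<b with b ∸ a | m<n⇒0<n∸m a<b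
... | suc _ | _ = refl

binom-neg : ∀ x n → binom x -[1+ n ] ≡ 0
binom-neg (+ _) n = refl
binom-neg -[1+ _ ] n = refl

binom-≤-endSets : ∀ a b m s → a + suc s ≤ m + b → binom (+ a - + b) (+ s) ≤ endSets m (suc s)
binom-≤-endSets a b m s h rewrite m-n≡m⊖n a b with b ≤? a
... | no b≰a = ≤-trans (≤-reflexive (binom-⊖-< (+ s) (≰⇒> b≰a))) z≤n
... | yes b≤a = begin
  binom (a ⊖ b) (+ s)                    ≡⟨ binom-⊖-≥ s b≤a ⟩
  (a ∸ b) C s                           ≤⟨ C≤endSets (a ∸ b) s ⟩
  endSets (a ∸ b + suc s) (suc s)        ≤⟨ endSets-monoˡ (≤⇒≤′ fits) ⟩
  endSets m (suc s) ∎
  where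
  open ≤-Reasoning
  fits : a ∸ b + suc s ≤ m
  fits = +-cancelʳ-≤ b _ _ (begin
    a ∸ b + suc s + b   ≡⟨ xy∙z≈xz∙y (a ∸ b) (suc s) b ⟩
    a ∸ b + b + suc s   ≡⟨ cong (_+ suc s) (m∸n+n≡m b≤a) ⟩
    a + suc s           ≤⟨ h ⟩
    m + b ∎)

binomials-≤-endSets : ∀ S k M r → S ≤ M + k →
  binom (+ suc S - + suc r - + 1) (+ suc r - + 1)
    + binom (+ suc S - + k - + suc r - + 2) (+ suc r - + 2)
    ≤ endSets S (suc r) + endSets M r
binomials-≤-endSets S k M r S≤M+k = +-mono-≤ first (second r)
  where
  first : binom (+ suc S - + suc r - + 1) (+ r) ≤ endSets S (suc r)
  first = subst (λ x → binom x (+ r) ≤ endSets S (suc r)) (sym (shift (+ S) (+ r)))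
    (binom-≤-endSets S (suc r) S r ≤-refl)
    where
    shift : ∀ (x y : ℤ) → + 1 ℤ.+ x - (+ 1 ℤ.+ y) - + 1 ≡ x - (+ 1 ℤ.+ y)
    shift = ℤ-Ring.solve-∀
  second : ∀ r → binom (+ suc S - + k - + suc r - + 2) (+ suc r - + 2) ≤ endSets M r
  second zero = ≤-trans (≤-reflexive (binom-neg (+ suc S - + k - + 1 - + 2) 0)) z≤n
  second (suc t) = subst (λ x → binom x (+ t) ≤ endSets M (suc t)) (sym (shift (+ S) (+ k) (+ t)))
    (binom-≤-endSets S (k + suc t + 2) M t fits)
    where
    shift : ∀ (x y z : ℤ) → + 1 ℤ.+ x - y - (+ 2 ℤ.+ z) - + 2 ≡ x - (y ℤ.+ (+ 1 ℤ.+ z) ℤ.+ + 2)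
    shift = ℤ-Ring.solve-∀
    fits : S + suc t ≤ M + (k + suc t + 2)
    fits = begin
      S + suc t              ≤⟨ +-monoˡ-≤ (suc t) S≤M+k ⟩
      M + k + suc t          ≤⟨ m≤m+n _ 2 ⟩
      M + k + suc t + 2      ≡⟨ reassoc M k (suc t) ⟩
      M + (k + suc t + 2) ∎
      where
      open ≤-Reasoning
      reassoc : ∀ x y z → x + y + z + 2 ≡ x + (y + z + 2)
      reassoc = ℕ-Ring.solve-∀

lemma6p1 : (ls : List ℕ) → 3 ≤ length ls → All (1 ≤_) ls →
    (i : Fin (length ls)) → (r : ℕ) → 1 ≤ r → r ≤ alpha ls →
    binom (+ numVertices ls - + r - + 1) (+ r - + 1)
      + binom (+ numVertices ls - + length ls - + r - + 2) (+ r - + 2)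
      ≤ sr ls r i
lemma6p1 ls k≥3 legs≥1 i zero () _
lemma6p1 ls k≥3 legs≥1 i (suc r) _ _ with m≤n⇒m<n∨m≡n (All.lookup legs≥1 (∈-lookup i))
... | inj₁ ℓ≥2 =
  let S≤M+k , endSets≤sr = endSets-≤-sr-longLeg ls i r ℓ≥2
  in ≤-trans (binomials-≤-endSets (sum ls) (length ls) _ r S≤M+k) endSets≤sr
... | inj₂ 1≡ℓ =
  let S≤M+k , endSets≤sr = endSets-≤-sr-shortLeg ls i r (sym 1≡ℓ) (≤-trans (s≤s z≤n) k≥3)
  in ≤-trans (binomials-≤-endSets (sum ls) (length ls) _ r S≤M+k) endSets≤sr
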